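{- Let $\mathcal{A}=\{[1,a_1],[1,a_2],\dots,[1,a_k]\}$ and $\mathcal{B}=\{[b_1,c_1],[b_2,c_2],\dots,[b_l,c_l]\}$ be multisets of intervals of positive integers such that for every integer $x$, the number of intervals in $\mathcal{A}$ containing $x$ is at least the number of intervals in $\mathcal{B}$ containing $x$. Then there is a partition $\mathcal{B}=\mathcal{B}_1\cup\mathcal{B}_2\cup\dots\cup\mathcal{B}_k$ such that for each $1\le i\le k$: all intervals in $\mathcal{B}_i$ are pairwise disjoint, and the union of the intervals in $\mathcal{B}_i$ is contained in $[1,a_i]$.
   Context: An interval $[b,c]$ of positive integers denotes the set $\{x\in\mathbb{Z}: b\le x\le c\}$, with $1\le b\le c$. The parts $\mathcal{B}_i$ of the partition may be empty. -}

module Defs where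

open import Data.Nat using (ℕ; zero; suc; _+_; _≤_; _<_; _≤?_)
open import Data.Fin using (Fin)
open import Data.Product using (_×_; _,_; proj₁; proj₂)
open import Relation.Nullary using (Dec; yes; no)
open import Data.Empty using (⊥)

-- An interval [b,c] of positive integers, represented by the pair (b , c);
-- validity (1 ≤ b ≤ c) is imposed as a hypothesis in the statement.
Interval : Set
Interval = ℕ × ℕ

lo : Interval → ℕ
lo = proj₁

hi : Interval → ℕ
hi = proj₂

_∈I_ : ℕ → Interval → Set
x ∈I I = lo I ≤ x × x ≤ hi I

_∈I?_ : (x : ℕ) → (I : Interval) → Dec (x ∈I I)
x ∈I? I with lo I ≤? x | x ≤? hi I
... | yes p | yes q = yes (p , q)
... | no ¬p | _     = no (λ r → ¬p (proj₁ r))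
... | yes _ | no ¬q = no (λ r → ¬q (proj₂ r))

countContaining : {n : ℕ} → (Fin n → Interval) → ℕ → ℕ
countContaining {zero} F x = 0
countContaining {suc n} F x with x ∈I? F Fin.zero
... | yes _ = suc (countContaining (λ j → F (Fin.suc j)) x)
... | no _  = countContaining (λ j → F (Fin.suc j)) x

Disjoint : Interval → Interval → Set
Disjoint I J = (x : ℕ) → x ∈I I → x ∈I J → ⊥

-- Remove an interval B j₀ whose right end h is
-- smallest and partition the rest into k classes. At h, the intervals of A strictly
-- outnumber the remaining intervals of B (B j₀ itself contains h), so by pigeonhole some
-- [1, a c] contains h while no remaining interval containing h is in class c. Put B j₀ into
-- class c: any interval meeting B j₀ ends at or after h, hence contains h, so it is not in c.
module Submission where

open import Defs
open import Data.Empty using (⊥-elim)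
open import Data.Fin using (Fin; zero; suc; punchIn; _≟_)
open import Data.Fin.Properties using (punchIn-punchOut; punchInᵢ≢i)
open import Data.Nat using (ℕ; zero; suc; _≤_; _<_; _≥_; z≤n; s≤s)
open import Data.Nat.Properties using (≤-refl; ≤-trans; ≤-total; ≤-pred; n≤1+n; m≤n⇒m≤1+n; module ≤-Reasoning)
open import Data.Product using (Σ; ∃; ∃-syntax; _×_; _,_; proj₁; proj₂)
open import Data.Sum using (inj₁; inj₂)
open import Data.Vec.Functional using (insertAt)
open import Data.Vec.Functional.Properties using (insertAt-lookup; insertAt-punchIn)
open import Function using (_∘_)
open import Level using (Level)
open import Relation.Binary.PropositionalEquality using (_≡_; _≢_; refl; sym; trans; cong; subst; subst₂)
open import Relation.Nullary using (yes; no)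
open import Relation.Unary using (Pred; Decidable; _⊆_)
open import Relation.Unary.Properties using (_∩?_; ∁?)

private variable
  ℓ ℓ′ : Level
  k l n : ℕ

count : {P : Pred (Fin n) ℓ} → Decidable P → ℕ
count {zero} P? = 0
count {suc n} P? with P? zero
... | yes _ = suc (count (P? ∘ suc))
... | no _  = count (P? ∘ suc)

count-mono : {P : Pred (Fin n) ℓ} {Q : Pred (Fin n) ℓ′} (P? : Decidable P) (Q? : Decidable Q) →
             P ⊆ Q → count P? ≤ count Q?
count-mono {zero}  P? Q? P⊆Q = z≤n
count-mono {suc n} P? Q? P⊆Q with P? zero | Q? zero | count-mono (P? ∘ suc) (Q? ∘ suc) P⊆Q
... | yes _ | yes _ | ih = s≤s ih
... | yes p | no ¬q | _  = ⊥-elim (¬q (P⊆Q p))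
... | no _  | yes _ | ih = m≤n⇒m≤1+n ih
... | no _  | no _  | ih = ih

count-punchIn≤ : {P : Pred (Fin (suc n)) ℓ} (P? : Decidable P) (i : Fin (suc n)) →
                 count (P? ∘ punchIn i) ≤ count P?
count-punchIn≤ P? zero with P? zero
... | yes _ = n≤1+n _
... | no _  = ≤-refl
count-punchIn≤ {suc n} P? (suc i) with P? zero | count-punchIn≤ (P? ∘ suc) i
... | yes _ | ih = s≤s ih
... | no _  | ih = ih

count-punchIn< : {P : Pred (Fin (suc n)) ℓ} (P? : Decidable P) (i : Fin (suc n)) →
                 P i → count (P? ∘ punchIn i) < count P?
count-punchIn< P? zero p with P? zero
... | yes _ = ≤-refl
... | no ¬p = ⊥-elim (¬p p)
count-punchIn< {suc n} P? (suc i) p with P? zero | count-punchIn< (P? ∘ suc) i p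
... | yes _ | ih = s≤s ih
... | no _  | ih = ih

count≤suc-punchIn : {P : Pred (Fin (suc n)) ℓ} (P? : Decidable P) (i : Fin (suc n)) →
                    count P? ≤ suc (count (P? ∘ punchIn i))
count≤suc-punchIn P? zero with P? zero
... | yes _ = ≤-refl
... | no _  = n≤1+n _
count≤suc-punchIn {suc n} P? (suc i) with P? zero | count≤suc-punchIn (P? ∘ suc) i
... | yes _ | ih = s≤s ih
... | no _  | ih = ih

count≤suc-count-≢ : {P : Pred (Fin n) ℓ} (P? : Decidable P) (c : Fin n) →
                    count P? ≤ suc (count (P? ∩? ∁? (_≟ c)))
count≤suc-count-≢ {suc n} P? c = ≤-trans (count≤suc-punchIn P? c) (s≤s (begin
  count (P? ∘ punchIn c)                  ≤⟨ count-mono _ _ (λ {j} p → p , punchInᵢ≢i c j) ⟩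
  count ((P? ∩? ∁? (_≟ c)) ∘ punchIn c)   ≤⟨ count-punchIn≤ (P? ∩? ∁? (_≟ c)) c ⟩
  count (P? ∩? ∁? (_≟ c))                 ∎))
  where open ≤-Reasoning

count>0⇒∃ : {P : Pred (Fin n) ℓ} (P? : Decidable P) → 0 < count P? → ∃ P
count>0⇒∃ {suc n} P? pos with P? zero
... | yes p = zero , p
... | no _  with count>0⇒∃ (P? ∘ suc) pos
...   | i , p = suc i , p

pigeonhole : {P : Pred (Fin k) ℓ} {Q : Pred (Fin l) ℓ′} (P? : Decidable P) (Q? : Decidable Q)
             (f : Fin l → Fin k) → count Q? < count P? →
             ∃[ i ] P i × (∀ j → Q j → f j ≢ i)
pigeonhole {l = zero} P? Q? f fewer with count>0⇒∃ P? fewer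
... | i , p = i , p , λ ()
pigeonhole {l = suc l} P? Q? f fewer with Q? zero
... | no ¬q with pigeonhole P? (Q? ∘ suc) (f ∘ suc) fewer
...   | i , p , missed = i , p , λ { zero q → ⊥-elim (¬q q) ; (suc j) → missed j }
pigeonhole {l = suc l} P? Q? f fewer | yes _
  with pigeonhole (P? ∩? ∁? (_≟ f zero)) (Q? ∘ suc) (f ∘ suc)
         (≤-pred (≤-trans fewer (count≤suc-count-≢ P? (f zero))))
...   | i , (p , i≢f0) , missed = i , p , λ { zero _ → i≢f0 ∘ sym ; (suc j) → missed j }

data PunchInView (i : Fin (suc n)) : Fin (suc n) → Set where
  at        : PunchInView i i
  punchedIn : (j : Fin n) → PunchInView i (punchIn i j)

punchInView : (i j : Fin (suc n)) → PunchInView i j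
punchInView i j with i ≟ j
... | yes refl = at
... | no i≢j   = subst (PunchInView i) (punchIn-punchOut i≢j) (punchedIn _)

argmin : (f : Fin (suc n) → ℕ) → ∃[ i ] (∀ j → f i ≤ f j)
argmin {zero}  f = zero , λ { zero → ≤-refl }
argmin {suc n} f with argmin (f ∘ suc)
... | i , min with ≤-total (f zero) (f (suc i))
...   | inj₁ f0≤ = zero  , λ { zero → ≤-refl ; (suc j) → ≤-trans f0≤ (min j) }
...   | inj₂ ≤f0 = suc i , λ { zero → ≤f0    ; (suc j) → min j }

∈I-mono : ∀ {x I J} → lo J ≤ lo I → hi I ≤ hi J → x ∈I I → x ∈I J
∈I-mono lo≤ ≤hi (lo≤x , x≤hi) = ≤-trans lo≤ lo≤x , ≤-trans x≤hi ≤hi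

overlap⇒hi∈I : ∀ {x I J} → x ∈I I → x ∈I J → hi I ≤ hi J → hi I ∈I J
overlap⇒hi∈I (_ , x≤hi) (lo≤x , _) hi≤hi = ≤-trans lo≤x x≤hi , hi≤hi

record Packing (a : Fin k → ℕ) (B : Fin l → Interval) (part : Fin l → Fin k) : Set where
  field
    disjoint : ∀ j j′ → j ≢ j′ → part j ≡ part j′ → Disjoint (B j) (B j′)
    inside   : ∀ j x → x ∈I B j → x ∈I (1 , a (part j))

packing-insertAt : {a : Fin k → ℕ} {B : Fin (suc l) → Interval} {part : Fin l → Fin k}
  (j₀ : Fin (suc l)) → 1 ≤ lo (B j₀) → (∀ j → hi (B j₀) ≤ hi (B j)) →
  Packing a (B ∘ punchIn j₀) part →
  (c : Fin k) → hi (B j₀) ∈I (1 , a c) → (∀ j → hi (B j₀) ∈I B (punchIn j₀ j) → part j ≢ c) →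
  Packing a B (insertAt part j₀ c)
packing-insertAt {a = a} {B} {part} j₀ 1≤lo minimal packing c hi∈c free = record
  { disjoint = disjoint ; inside = inside }
  where
  module P = Packing packing

  class-at : insertAt part j₀ c j₀ ≡ c
  class-at = insertAt-lookup part j₀ c

  class-punchedIn : ∀ j → insertAt part j₀ c (punchIn j₀ j) ≡ part j
  class-punchedIn = insertAt-punchIn part j₀ c

  disjoint : ∀ j j′ → j ≢ j′ → insertAt part j₀ c j ≡ insertAt part j₀ c j′ → Disjoint (B j) (B j′)
  disjoint j j′ j≢j′ same x x∈ x∈′ with punchInView j₀ j | punchInView j₀ j′
  ... | at | at = j≢j′ refl
  ... | at | punchedIn j₁ =
    free j₁ (overlap⇒hi∈I x∈ x∈′ (minimal _)) (trans (sym (class-punchedIn j₁)) (trans (sym same) class-at))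
  ... | punchedIn j₁ | at =
    free j₁ (overlap⇒hi∈I x∈′ x∈ (minimal _)) (trans (sym (class-punchedIn j₁)) (trans same class-at))
  ... | punchedIn j₁ | punchedIn j₁′ =
    P.disjoint j₁ j₁′ (j≢j′ ∘ cong (punchIn j₀))
      (trans (sym (class-punchedIn j₁)) (trans same (class-punchedIn j₁′))) x x∈ x∈′

  inside : ∀ j x → x ∈I B j → x ∈I (1 , a (insertAt part j₀ c j))
  inside j x x∈ with punchInView j₀ j
  ... | at rewrite class-at = ∈I-mono 1≤lo (proj₂ hi∈c) x∈
  ... | punchedIn j₁ rewrite class-punchedIn j₁ = P.inside j₁ x x∈

countContaining≡count : (F : Fin n → Interval) (x : ℕ) → countContaining F x ≡ count (λ i → x ∈I? F i)
countContaining≡count {zero}  F x = refl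
countContaining≡count {suc n} F x with x ∈I? F zero
... | yes _ = cong suc (countContaining≡count (F ∘ suc) x)
... | no _  = countContaining≡count (F ∘ suc) x

packing-exists : (a : Fin k → ℕ) (B : Fin l → Interval) →
  (∀ j → 1 ≤ lo (B j) × lo (B j) ≤ hi (B j)) →
  (∀ x → count (λ j → x ∈I? B j) ≤ count (λ i → x ∈I? (1 , a i))) →
  ∃ (Packing a B)
packing-exists {l = zero}  a B valid covered = (λ ()) , record { disjoint = λ () ; inside = λ () }
packing-exists {l = suc l} a B valid covered =
  let (j₀ , minimal) = argmin (hi ∘ B)
      h = hi (B j₀)
      (part , packing) = packing-exists a (B ∘ punchIn j₀) (valid ∘ punchIn j₀)
        (λ x → ≤-trans (count-punchIn≤ (λ j → x ∈I? B j) j₀) (covered x))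
      (c , h∈c , free) = pigeonhole (λ i → h ∈I? (1 , a i)) (λ j → h ∈I? B (punchIn j₀ j)) part
        (≤-trans (count-punchIn< (λ j → h ∈I? B j) j₀ (proj₂ (valid j₀) , ≤-refl)) (covered h))
  in insertAt part j₀ c , packing-insertAt j₀ (proj₁ (valid j₀)) minimal packing c h∈c free

lemma4p2 : (k l : ℕ) (a : Fin k → ℕ) (B : Fin l → Interval)
    → ((i : Fin k) → 1 ≤ a i)
    → ((j : Fin l) → 1 ≤ lo (B j) × lo (B j) ≤ hi (B j))
    → ((x : ℕ) → countContaining (λ i → (1 , a i)) x ≥ countContaining B x)
    → Σ (Fin l → Fin k) (λ part →
        ((j j′ : Fin l) → j ≢ j′ → part j ≡ part j′ → Disjoint (B j) (B j′))
        × ((j : Fin l) (x : ℕ) → x ∈I B j → x ∈I (1 , a (part j))))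
lemma4p2 k l a B _ valid covered =
  let (part , packing) = packing-exists a B valid λ x →
        subst₂ _≤_ (countContaining≡count B x) (countContaining≡count (λ i → (1 , a i)) x) (covered x)
  in part , Packing.disjoint packing , Packing.inside packing
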